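{- Let $P$ and $Q$ be two vertex-disjoint induced paths of $G_{nbd}$ such that there are no edges between $V(P)$ and $V(Q)$, $\mathsf{sp}(P)\neq V(C)$ and $\mathsf{sp}(Q)\neq V(C)$. If $x,y,z\in \mathsf{sp}(P)\cap\mathsf{sp}(Q)$ are three consecutive vertices of $C$, then $G[Z_{\{x,y,z\}}]$ contains a hole.
   Context: Graphs are finite and simple. A hole is an induced cycle of length at least $4$; a graph is chordal if it has no hole. Let $s_k=4k(\log k+\log\log k+4)$ for $k\ge2$, $s_1=2$, and $\mu_k=76s_{k+1}+3217k+1985$. Standing assumptions: $G$ is a graph, $k$ a positive integer, $C$ a shortest hole of $G$ of length strictly greater than $\mu_k$, and $G-V(C)$ is chordal. $D$ is the set of vertices of $G$ adjacent to every vertex of $C$; $G_{nbd}=G[N[V(C)]\setminus D]$. For $v\in V(C)$, $Z_v=\{v\}\cup(N(v)\setminus V(C)\setminus D)$, and $Z_S=\bigcup_{v\in S}Z_v$. For a subgraph $H$, $\mathsf{sp}(H)$ is the set of $v\in V(C)$ with $(Z_v\cup D)\cap V(H)\neq\emptyset$. -}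

module Defs where

open import Level using (0ℓ)
open import Data.Nat using (ℕ; zero; suc; _≤_)
open import Data.Fin using (Fin; toℕ)
open import Data.Product using (Σ; ∃; _×_; _,_)
open import Data.Sum using (_⊎_)
open import Data.Empty using (⊥)
open import Relation.Nullary using (¬_; Dec)
open import Relation.Binary.PropositionalEquality using (_≡_; _≢_)
open import Function.Bundles using (_⇔_)
open import Function.Definitions using (Injective)

record Graph : Set₁ where
  field
    n     : ℕ
    E     : Fin n → Fin n → Set
    E-dec : ∀ u v → Dec (E u v)
    E-sym : ∀ {u v} → E u v → E v u
    E-irr : ∀ {u} → ¬ E u u

module _ (G : Graph) where
  open Graph G

  V : Set
  V = Fin n

  Consec : ℕ → ℕ → Set
  Consec a b = suc a ≡ b ⊎ suc b ≡ a

  CycConsec : ℕ → ℕ → ℕ → Set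
  CycConsec m a b = Consec a b ⊎ ((a ≡ 0 × suc b ≡ m) ⊎ (b ≡ 0 × suc a ≡ m))

  CycSucc : (m : ℕ) → Fin m → Fin m → Set
  CycSucc m i j = suc (toℕ i) ≡ toℕ j ⊎ (suc (toℕ i) ≡ m × toℕ j ≡ 0)

  IsInducedPath : {m : ℕ} → (Fin (suc m) → V) → Set
  IsInducedPath {m} P =
    Injective _≡_ _≡_ P ×
    (∀ i j → E (P i) (P j) ⇔ Consec (toℕ i) (toℕ j))

  IsHole : {m : ℕ} → (Fin m → V) → Set
  IsHole {m} H =
    4 ≤ m ×
    Injective _≡_ _≡_ H ×
    (∀ i j → E (H i) (H j) ⇔ CycConsec m (toℕ i) (toℕ j))

  _∈V_ : {m : ℕ} → V → (Fin m → V) → Set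
  v ∈V H = ∃ λ i → H i ≡ v

  module _ {L : ℕ} (C : Fin L → V) where

    InD : V → Set
    InD u = ∀ i → E u (C i)

    InClosedNbd : V → Set
    InClosedNbd u = u ∈V C ⊎ (∃ λ i → E u (C i))

    InGnbd : V → Set
    InGnbd u = InClosedNbd u × ¬ InD u

    InZ : V → V → Set
    InZ v u = u ≡ v ⊎ (E v u × ¬ (u ∈V C) × ¬ InD u)

    InSp : {m : ℕ} → (Fin m → V) → V → Set
    InSp P v = v ∈V C × (∃ λ i → InZ v (P i) ⊎ InD (P i))

    SpNotAll : {m : ℕ} → (Fin m → V) → Set
    SpNotAll P = ¬ (∀ i → InSp P (C i))

    ThreeConsecutive : V → V → V → Set
    ThreeConsecutive x y z =
      ∃ λ a → ∃ λ b → ∃ λ c →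
        CycSucc L a b × CycSucc L b c × C a ≡ x × C b ≡ y × C c ≡ z

    IsShortestHole : Set
    IsShortestHole = IsHole C × (∀ {m} (H : Fin m → V) → IsHole H → L ≤ m)

    ChordalMinusC : Set
    ChordalMinusC = ∀ {m} (H : Fin m → V) → IsHole H → ¬ (∀ i → ¬ (H i ∈V C))

    IsInducedPathOfGnbd : {m : ℕ} → (Fin (suc m) → V) → Set
    IsInducedPathOfGnbd P = IsInducedPath P × (∀ i → InGnbd (P i))

    HoleInZ3 : V → V → V → Set
    HoleInZ3 x y z = ∃ λ m → Σ (Fin m → V) λ H →
      IsHole H × (∀ i → InZ x (H i) ⊎ InZ y (H i) ⊎ InZ z (H i))

μ₁-ceil : ℕ
μ₁-ceil = 7833

{-# OPTIONS --safe #-}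
-- Cut C open at a vertex C k outside sp(P): with c 0 = C k, the positions 1, …, L - 1
-- of C form an induced path, and every vertex of P lies in Z_{c p} for some such position p.
-- Since C is a shortest hole of length at least 7, the positions attached to the two ends of an
-- edge of P form an interval: otherwise a vertex (or an edge) leaving a gap would close two holes,
-- one across the gap and one through C k, whose lengths add up to at most L + 6.  A minimal subpath
-- of P from Z_x to Z_z has inner vertices attached neither to x nor to z, so by this interval
-- property they are attached to y only and lie in Z_y.  Doing the same in Q, the two subpaths are
-- disjoint and anticomplete, and x, z are distinct and non-adjacent, so together with x and z
-- they form a hole in G[Z_{x,y,z}].
module Submission where

open import Defs
open import Data.Nat using (ℕ; zero; suc; _+_; _*_; >-nonZero; _∸_; _≤_; _<_; _%_; z≤n; s≤s; s≤s⁻¹; _≤?_; _<?_; NonZero)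
open import Data.Nat.Properties
open import Data.Nat.Tactic.RingSolver using (solve-∀)
open import Algebra.Properties.CommutativeSemigroup +-commutativeSemigroup using (x∙yz≈y∙xz)
open import Data.Nat.DivMod using (_/_; _mod_; m≡m%n+[m/n]*n; [m+kn]%n≡m%n; [m+n]%n≡m%n; m%n<n; m<n⇒m%n≡m; m≤n⇒[n∸m]%m≡n%m; n%n≡0)
open import Data.Fin as Fin using (Fin; toℕ)
open import Data.Fin.Properties using (toℕ-injective; toℕ<n; toℕ-fromℕ<; any?; all?; ¬∀⟶∃¬)
open import Data.Product using (Σ; ∃; _×_; _,_; proj₁; proj₂)
open import Data.Sum using (_⊎_; inj₁; inj₂; swap)
open import Data.Empty using (⊥; ⊥-elim)
open import Data.Unit using (⊤; tt)
open import Relation.Nullary using (¬_; Dec; yes; no; ¬?)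
open import Relation.Nullary.Decidable using (_×-dec_; _⊎-dec_)
open import Function using (_∘_)
open import Relation.Unary using (Decidable)
open import Relation.Binary.PropositionalEquality
open import Relation.Binary.Definitions using (tri<; tri≈; tri>)
open import Function.Bundles using (Equivalence; mk⇔)

module _ {Q : ℕ → Set} (Q? : Decidable Q) where

  record GreatestBelow (i n : ℕ) : Set where
    field
      a      : ℕ
      i≤a    : i ≤ a
      a<n    : a < n
      holds  : Q a
      beyond : ∀ {t} → a < t → t < n → ¬ Q t

  greatestBelow : ∀ {i n} → Q i → i < n → GreatestBelow i n
  greatestBelow {i} {suc n} Qi i<1+n with Q? n
  ... | yes Qn = record
    { a = n ; i≤a = s≤s⁻¹ i<1+n ; a<n = ≤-refl ; holds = Qn
    ; beyond = λ n<t t<1+n _ → <⇒≱ n<t (s≤s⁻¹ t<1+n) }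
  ... | no ¬Qn = record
    { a = a ; i≤a = i≤a ; a<n = m<n⇒m<1+n a<n ; holds = holds ; beyond = beyond′ }
    where
    i<n : i < n
    i<n = ≤∧≢⇒< (s≤s⁻¹ i<1+n) (λ i≡n → ¬Qn (subst Q i≡n Qi))
    open GreatestBelow (greatestBelow Qi i<n)
    beyond′ : ∀ {t} → a < t → t < suc n → ¬ Q t
    beyond′ a<t t<1+n with m≤n⇒m<n∨m≡n (s≤s⁻¹ t<1+n)
    ... | inj₁ t<n  = beyond a<t t<n
    ... | inj₂ refl = ¬Qn

  record LeastAbove (i j : ℕ) : Set where
    field
      b      : ℕ
      i≤b    : i ≤ b
      b≤j    : b ≤ j
      holds  : Q b
      before : ∀ {t} → i ≤ t → t < b → ¬ Q t

  leastAbove+ : ∀ i d → Q (i + d) → LeastAbove i (i + d)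
  leastAbove+ i d Qi+d with Q? i
  ... | yes Qi = record
    { b = i ; i≤b = ≤-refl ; b≤j = m≤m+n i d ; holds = Qi ; before = λ i≤t t<i _ → <⇒≱ t<i i≤t }
  leastAbove+ i zero    Qi+d | no ¬Qi = ⊥-elim (¬Qi (subst Q (+-identityʳ i) Qi+d))
  leastAbove+ i (suc d) Qi+d | no ¬Qi = record
    { b = b ; i≤b = <⇒≤ i<b ; b≤j = subst (b ≤_) (sym (+-suc i d)) b≤j
    ; holds = holds ; before = before′ }
    where
    open LeastAbove (leastAbove+ (suc i) d (subst Q (+-suc i d) Qi+d)) renaming (i≤b to i<b)
    before′ : ∀ {t} → i ≤ t → t < b → ¬ Q t
    before′ i≤t t<b with m≤n⇒m<n∨m≡n i≤t
    ... | inj₁ i<t  = before i<t t<b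
    ... | inj₂ refl = ¬Qi

  leastAbove : ∀ {i j} → Q j → i ≤ j → LeastAbove i j
  leastAbove {i} Qj i≤j with m≤n⇒∃[o]m+o≡n i≤j
  ... | d , refl = leastAbove+ i d Qj

-- T t p: vertex t of a walk of length m is attached to position p.
module AttachmentWalk {L m r : ℕ} (T : ℕ → ℕ → Set)
  (convex : ∀ {t p k q} → t < m → p < k → k < q → q < L →
            T t p ⊎ T (suc t) p → T t q ⊎ T (suc t) q → T t k ⊎ T (suc t) k)
  (inhabited : ∀ {t} → 0 < t → t < m → ∃ λ p → p < L × T t p)
  (2+r<L : 2 + r < L)
  (r-at-start : T 0 r) (r-only-at-start : ∀ {t} → t ≤ m → T t r → t ≡ 0)
  (2+r-at-end : T m (2 + r)) (2+r-only-at-end : ∀ {t} → t ≤ m → T t (2 + r) → t ≡ m) where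

  r<2+r : r < 2 + r
  r<2+r = n≤1+n (suc r)

  inner-avoids-r : ∀ {t} → 0 < t → t ≤ m → ¬ T t r
  inner-avoids-r 0<t t≤m Ttr = <⇒≢ 0<t (sym (r-only-at-start t≤m Ttr))

  inner-avoids-2+r : ∀ {t} → t < m → ¬ T t (2 + r)
  inner-avoids-2+r t<m Tt = <⇒≢ t<m (2+r-only-at-end (<⇒≤ t<m) Tt)

  crossing-r : ∀ {t p q} → 0 < t → t < m → p < r → r < q → q < L → T t p → T (suc t) q → ⊥
  crossing-r 0<t t<m p<r r<q q<L Ttp T1+tq with convex t<m p<r r<q q<L (inj₁ Ttp) (inj₂ T1+tq)
  ... | inj₁ Ttr   = inner-avoids-r 0<t (<⇒≤ t<m) Ttr
  ... | inj₂ T1+tr = inner-avoids-r (s≤s z≤n) t<m T1+tr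

  crossing-2+r : ∀ {t p q} → suc t < m → p < 2 + r → 2 + r < q → q < L → T t p → T (suc t) q → ⊥
  crossing-2+r 1+t<m p<2+r 2+r<q q<L Ttp T1+tq
    with convex (<-trans (n<1+n _) 1+t<m) p<2+r 2+r<q q<L (inj₁ Ttp) (inj₂ T1+tq)
  ... | inj₁ Tt   = inner-avoids-2+r (<-trans (n<1+n _) 1+t<m) Tt
  ... | inj₂ T1+t = inner-avoids-2+r 1+t<m T1+t

  none-below : ∀ d {t} → 0 < t → t + suc d ≡ m → ∀ {p} → p < r → ¬ T t p
  none-below zero {t} 0<t t+1≡m p<r Ttp =
    crossing-r 0<t (≤-reflexive 1+t≡m) p<r r<2+r 2+r<L Ttp (subst (λ s → T s (2 + r)) (sym 1+t≡m) 2+r-at-end)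
    where
    1+t≡m : suc t ≡ m
    1+t≡m = trans (+-comm 1 t) t+1≡m
  none-below (suc d) {t} 0<t t+2+d≡m p<r Ttp = next (inhabited (s≤s z≤n) 1+t<m)
    where
    1+t+1+d≡m : suc t + suc d ≡ m
    1+t+1+d≡m = trans (sym (+-suc t (suc d))) t+2+d≡m
    1+t<m : suc t < m
    1+t<m = subst (suc t <_) 1+t+1+d≡m (m<m+n (suc t) (s≤s z≤n))
    next : (∃ λ q → q < L × T (suc t) q) → ⊥
    next (q , q<L , T1+tq) with <-cmp q r
    ... | tri< q<r _ _  = none-below d (s≤s z≤n) 1+t+1+d≡m q<r T1+tq
    ... | tri≈ _ refl _ = inner-avoids-r (s≤s z≤n) (<⇒≤ 1+t<m) T1+tq
    ... | tri> _ _ r<q  = crossing-r 0<t (<-trans (n<1+n t) 1+t<m) p<r r<q q<L Ttp T1+tq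

  none-above : ∀ t → suc t < m → ∀ {q} → 2 + r < q → q < L → ¬ T (suc t) q
  none-above zero    1<m   2+r<q q<L T1q = crossing-2+r 1<m r<2+r 2+r<q q<L r-at-start T1q
  none-above (suc t) 2+t<m 2+r<q q<L T2+tq with inhabited (s≤s z≤n) (<-trans (n<1+n _) 2+t<m)
  ... | p , p<L , T1+tp with <-cmp p (2 + r)
  ...   | tri< p<2+r _ _ = crossing-2+r 2+t<m p<2+r 2+r<q q<L T1+tp T2+tq
  ...   | tri≈ _ refl _  = inner-avoids-2+r (<-trans (n<1+n _) 2+t<m) T1+tp
  ...   | tri> _ _ 2+r<p = none-above t (<-trans (n<1+n _) 2+t<m) 2+r<p p<L T1+tp

  inner-attachment≡1+r : ∀ {t p} → 0 < t → t < m → p < L → T t p → p ≡ suc r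
  inner-attachment≡1+r {zero}  ()
  inner-attachment≡1+r {suc t} {p} 0<t t<m p<L Ttp with <-cmp p r
  ... | tri< p<r _ _  = ⊥-elim (none-below d 0<t (trans (+-suc (suc t) d) 1+t+d≡m) p<r Ttp)
    where
    d : ℕ
    d = proj₁ (m≤n⇒∃[o]m+o≡n t<m)
    1+t+d≡m : suc (suc t) + d ≡ m
    1+t+d≡m = proj₂ (m≤n⇒∃[o]m+o≡n t<m)
  ... | tri≈ _ refl _ = ⊥-elim (inner-avoids-r 0<t (<⇒≤ t<m) Ttp)
  ... | tri> _ _ r<p with <-cmp p (2 + r)
  ...   | tri< p<2+r _ _ = ≤-antisym (s≤s⁻¹ p<2+r) r<p
  ...   | tri≈ _ refl _  = ⊥-elim (inner-avoids-2+r t<m Ttp)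
  ...   | tri> _ _ 2+r<p = ⊥-elim (none-above t t<m 2+r<p p<L Ttp)

module Paths (G : Graph) where
  open Graph G using (E; E-sym; E-irr)

  record InducedPath (R : ℕ → V G) (n : ℕ) : Set where
    field
      injective   : ∀ {i j} → i ≤ n → j ≤ n → R i ≡ R j → i ≡ j
      edge⇒consec : ∀ {i j} → i ≤ n → j ≤ n → E (R i) (R j) → Consec G i j
      step        : ∀ {i} → i < n → E (R i) (R (suc i))

  inducedPath-cong : ∀ {R R′ n} → (∀ t → R t ≡ R′ t) → InducedPath R n → InducedPath R′ n
  inducedPath-cong R≗R′ p = record
    { injective   = λ i≤n j≤n eq → injective i≤n j≤n (trans (R≗R′ _) (trans eq (sym (R≗R′ _))))
    ; edge⇒consec = λ i≤n j≤n e → edge⇒consec i≤n j≤n (subst₂ E (sym (R≗R′ _)) (sym (R≗R′ _)) e)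
    ; step        = λ i<n → subst₂ E (R≗R′ _) (R≗R′ _) (step i<n) }
    where open InducedPath p

  singleton-inducedPath : ∀ v → InducedPath (λ _ → v) 0
  singleton-inducedPath v = record
    { injective = λ { z≤n z≤n _ → refl } ; edge⇒consec = λ _ _ e → ⊥-elim (E-irr e) ; step = λ () }

  consec-cancelˡ : ∀ a {i j} → Consec G (a + i) (a + j) → Consec G i j
  consec-cancelˡ a {i} (inj₁ eq)     = inj₁ (+-cancelˡ-≡ a _ _ (trans (+-suc a i) eq))
  consec-cancelˡ a {j = j} (inj₂ eq) = inj₂ (+-cancelˡ-≡ a _ _ (trans (+-suc a j) eq))

  consec-shiftˡ : ∀ a {i j} → Consec G i j → Consec G (a + i) (a + j)
  consec-shiftˡ a {i} (inj₁ refl)     = inj₁ (sym (+-suc a i))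
  consec-shiftˡ a {j = j} (inj₂ refl) = inj₂ (sym (+-suc a j))

  drop-inducedPath : ∀ {R n} a {d} → a + d ≤ n → InducedPath R n → InducedPath (λ t → R (a + t)) d
  drop-inducedPath {R} {n} a {d} a+d≤n p = record
    { injective   = λ i≤d j≤d eq → +-cancelˡ-≡ a _ _ (injective (shift i≤d) (shift j≤d) eq)
    ; edge⇒consec = λ i≤d j≤d e → consec-cancelˡ a (edge⇒consec (shift i≤d) (shift j≤d) e)
    ; step        = λ {i} i<d → subst (λ t → E (R (a + i)) (R t)) (sym (+-suc a i))
                                  (step (<-≤-trans (+-monoʳ-< a i<d) a+d≤n)) }
    where
    open InducedPath p
    shift : ∀ {t} → t ≤ d → a + t ≤ n
    shift t≤d = ≤-trans (+-monoʳ-≤ a t≤d) a+d≤n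

  ∸-consec : ∀ {n i j} → i ≤ n → j ≤ n → suc (n ∸ i) ≡ n ∸ j → suc j ≡ i
  ∸-consec {n} {i} {j} i≤n j≤n eq = +-cancelˡ-≡ (n ∸ i) _ _ (begin
    n ∸ i + suc j   ≡⟨ +-suc (n ∸ i) j ⟩
    suc (n ∸ i) + j ≡⟨ cong (_+ j) eq ⟩
    n ∸ j + j       ≡⟨ m∸n+n≡m j≤n ⟩
    n               ≡⟨ m∸n+n≡m i≤n ⟨
    n ∸ i + i       ∎)
    where open ≡-Reasoning

  reverse-inducedPath : ∀ {R n} → InducedPath R n → InducedPath (λ t → R (n ∸ t)) n
  reverse-inducedPath {R} {n} p = record
    { injective   = λ {i} {j} i≤n j≤n eq → ∸-cancelˡ-≡ i≤n j≤n (injective (m∸n≤m n i) (m∸n≤m n j) eq)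
    ; edge⇒consec = λ {i} {j} i≤n j≤n e → flip i≤n j≤n (edge⇒consec (m∸n≤m n i) (m∸n≤m n j) e)
    ; step        = λ {i} i<n → E-sym (subst (λ t → E (R (n ∸ suc i)) (R t)) (sym (+-∸-assoc 1 i<n))
                                         (step (∸-monoʳ-< (s≤s z≤n) i<n))) }
    where
    open InducedPath p
    flip : ∀ {i j} → i ≤ n → j ≤ n → Consec G (n ∸ i) (n ∸ j) → Consec G i j
    flip i≤n j≤n (inj₁ eq) = inj₂ (∸-consec i≤n j≤n eq)
    flip i≤n j≤n (inj₂ eq) = inj₁ (∸-consec j≤n i≤n eq)

  append : (ℕ → V G) → ℕ → (ℕ → V G) → ℕ → V G
  append R₁ n₁ R₂ t with t ≤? n₁
  ... | yes _ = R₁ t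
  ... | no  _ = R₂ (t ∸ suc n₁)

  module _ (R₁ : ℕ → V G) (n₁ : ℕ) (R₂ : ℕ → V G) where

    data AppendView (t : ℕ) : Set where
      left  : t ≤ n₁ → append R₁ n₁ R₂ t ≡ R₁ t → AppendView t
      right : ∀ t′ → t ≡ suc n₁ + t′ → append R₁ n₁ R₂ t ≡ R₂ t′ → AppendView t

    append-left : ∀ {t} → t ≤ n₁ → append R₁ n₁ R₂ t ≡ R₁ t
    append-left {t} t≤n₁ with t ≤? n₁
    ... | yes _    = refl
    ... | no  t≰n₁ = ⊥-elim (t≰n₁ t≤n₁)

    append-right : ∀ t → append R₁ n₁ R₂ (suc n₁ + t) ≡ R₂ t
    append-right t with suc n₁ + t ≤? n₁
    ... | yes n₁<n₁+t = ⊥-elim (<⇒≱ (m≤m+n (suc n₁) t) n₁<n₁+t)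
    ... | no  _       = cong R₂ (m+n∸m≡n (suc n₁) t)

    append-view : ∀ t → AppendView t
    append-view t with t ≤? n₁
    ... | yes t≤n₁ = left t≤n₁ (append-left t≤n₁)
    ... | no  t≰n₁ = right (t ∸ suc n₁) t≡ (trans (cong (append R₁ n₁ R₂) t≡) (append-right _))
      where
      t≡ : t ≡ suc n₁ + (t ∸ suc n₁)
      t≡ = sym (m+[n∸m]≡n (≰⇒> t≰n₁))

    append-inducedPath : ∀ {n₂} → InducedPath R₁ n₁ → InducedPath R₂ n₂ → E (R₁ n₁) (R₂ 0) →
      (∀ {t t′} → t ≤ n₁ → t′ ≤ n₂ → R₁ t ≢ R₂ t′) →
      (∀ {t t′} → t ≤ n₁ → t′ ≤ n₂ → E (R₁ t) (R₂ t′) → t ≡ n₁ × t′ ≡ 0) →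
      InducedPath (append R₁ n₁ R₂) (suc n₁ + n₂)
    append-inducedPath {n₂} p₁ p₂ link disjoint cross = record
      { injective   = λ {i} {j} → inj (append-view i) (append-view j)
      ; edge⇒consec = λ {i} {j} → adj (append-view i) (append-view j)
      ; step        = λ {i} → stp (append-view i) }
      where
      A : ℕ → V G
      A = append R₁ n₁ R₂
      module P₁ = InducedPath p₁
      module P₂ = InducedPath p₂
      unshift : ∀ {t} → suc n₁ + t ≤ suc n₁ + n₂ → t ≤ n₂
      unshift = +-cancelˡ-≤ (suc n₁) _ _
      inj : ∀ {i j} → AppendView i → AppendView j → i ≤ suc n₁ + n₂ → j ≤ suc n₁ + n₂ →
            A i ≡ A j → i ≡ j
      inj (left i≤ ei) (left j≤ ej) _ _ eq = P₁.injective i≤ j≤ (trans (sym ei) (trans eq ej))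
      inj (left i≤ ei) (right _ refl ej) _ j≤ eq =
        ⊥-elim (disjoint i≤ (unshift j≤) (trans (sym ei) (trans eq ej)))
      inj (right _ refl ei) (left j≤ ej) i≤ _ eq =
        ⊥-elim (disjoint j≤ (unshift i≤) (trans (sym ej) (trans (sym eq) ei)))
      inj (right _ refl ei) (right _ refl ej) i≤ j≤ eq =
        cong (suc n₁ +_) (P₂.injective (unshift i≤) (unshift j≤) (trans (sym ei) (trans eq ej)))
      adj : ∀ {i j} → AppendView i → AppendView j → i ≤ suc n₁ + n₂ → j ≤ suc n₁ + n₂ →
            E (A i) (A j) → Consec G i j
      adj (left i≤ ei) (left j≤ ej) _ _ e = P₁.edge⇒consec i≤ j≤ (subst₂ E ei ej e)
      adj (left i≤ ei) (right _ refl ej) _ j≤ e with cross i≤ (unshift j≤) (subst₂ E ei ej e)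
      ... | refl , refl = inj₁ (sym (+-identityʳ (suc n₁)))
      adj (right _ refl ei) (left j≤ ej) i≤ _ e with cross j≤ (unshift i≤) (E-sym (subst₂ E ei ej e))
      ... | refl , refl = inj₂ (sym (+-identityʳ (suc n₁)))
      adj (right _ refl ei) (right _ refl ej) i≤ j≤ e =
        consec-shiftˡ (suc n₁) (P₂.edge⇒consec (unshift i≤) (unshift j≤) (subst₂ E ei ej e))
      stp : ∀ {i} → AppendView i → i < suc n₁ + n₂ → E (A i) (A (suc i))
      stp (left i≤ ei) _ with m≤n⇒m<n∨m≡n i≤
      ... | inj₁ i<n₁ = subst₂ E (sym ei) (sym (append-left i<n₁)) (P₁.step i<n₁)
      ... | inj₂ refl = subst₂ E (sym ei) (sym (trans (cong A (sym (+-identityʳ (suc n₁)))) (append-right 0))) link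
      stp (right t refl ei) lt =
        subst₂ E (sym ei) (sym (trans (cong A (sym (+-suc (suc n₁) t))) (append-right (suc t))))
          (P₂.step (+-cancelˡ-< (suc n₁) _ _ lt))

  cons : V G → (ℕ → V G) → ℕ → V G
  cons u R zero    = u
  cons u R (suc t) = R t

  cons-isHole : ∀ {u R n} → InducedPath R n → 2 ≤ n → (∀ {t} → t ≤ n → R t ≢ u) →
    E u (R 0) → E u (R n) → (∀ {t} → t ≤ n → E u (R t) → t ≡ 0 ⊎ t ≡ n) →
    IsHole G (λ (i : Fin (2 + n)) → cons u R (toℕ i))
  cons-isHole {u} {R} {n} p 2≤n R≢u u-R0 u-Rn u-only =
    s≤s (s≤s 2≤n) , (λ eq → toℕ-injective (inj (toℕ<n _) (toℕ<n _) eq)) ,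
    λ i j → mk⇔ (to (toℕ<n i) (toℕ<n j)) (from (toℕ<n i) (toℕ<n j))
    where
    open InducedPath p
    H : ℕ → V G
    H = cons u R
    bound : ∀ {t} → suc t < 2 + n → t ≤ n
    bound t< = s≤s⁻¹ (s≤s⁻¹ t<)
    inj : ∀ {a b} → a < 2 + n → b < 2 + n → H a ≡ H b → a ≡ b
    inj {zero}  {zero}  _  _  _  = refl
    inj {zero}  {suc b} _  b< eq = ⊥-elim (R≢u (bound b<) (sym eq))
    inj {suc a} {zero}  a< _  eq = ⊥-elim (R≢u (bound a<) eq)
    inj {suc a} {suc b} a< b< eq = cong suc (injective (bound a<) (bound b<) eq)
    to : ∀ {a b} → a < 2 + n → b < 2 + n → E (H a) (H b) → CycConsec G (2 + n) a b
    to {zero}  {zero}  _  _  e = ⊥-elim (E-irr e)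
    to {zero}  {suc b} _  b< e with u-only (bound b<) e
    ... | inj₁ refl = inj₁ (inj₁ refl)
    ... | inj₂ refl = inj₂ (inj₁ (refl , refl))
    to {suc a} {zero}  a< _  e with u-only (bound a<) (E-sym e)
    ... | inj₁ refl = inj₁ (inj₂ refl)
    ... | inj₂ refl = inj₂ (inj₂ (refl , refl))
    to {suc a} {suc b} a< b< e with edge⇒consec (bound a<) (bound b<) e
    ... | inj₁ eq = inj₁ (inj₁ (cong suc eq))
    ... | inj₂ eq = inj₁ (inj₂ (cong suc eq))
    from : ∀ {a b} → a < 2 + n → b < 2 + n → CycConsec G (2 + n) a b → E (H a) (H b)
    from {zero}      _  _  (inj₁ (inj₁ refl))         = u-R0
    from {suc a}     _  b< (inj₁ (inj₁ refl))         = step (bound b<)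
    from {b = zero}  _  _  (inj₁ (inj₂ refl))         = E-sym u-R0
    from {b = suc b} a< _  (inj₁ (inj₂ refl))         = E-sym (step (bound a<))
    from             _  _  (inj₂ (inj₁ (refl , refl))) = u-Rn
    from             _  _  (inj₂ (inj₂ (refl , refl))) = E-sym u-Rn

  record InteriorPath (x z : V G) (F : ℕ → V G) (m : ℕ) : Set where
    field
      path         : InducedPath F m
      ≢x           : ∀ {t} → t ≤ m → F t ≢ x
      ≢z           : ∀ {t} → t ≤ m → F t ≢ z
      x-first      : E x (F 0)
      z-last       : E z (F m)
      x-only-first : ∀ {t} → t ≤ m → E x (F t) → t ≡ 0
      z-only-last  : ∀ {t} → t ≤ m → E z (F t) → t ≡ m

  inner-interior : ∀ {A d} → InducedPath A (2 + d) → InteriorPath (A 0) (A (2 + d)) (λ t → A (suc t)) d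
  inner-interior {A} {d} p = record
    { path         = drop-inducedPath 1 (n≤1+n (suc d)) p
    ; ≢x           = λ t≤d eq → 1+n≢0 (injective (s≤s (m≤n⇒m≤1+n t≤d)) z≤n eq)
    ; ≢z           = λ t≤d eq → <⇒≢ (s≤s (s≤s t≤d)) (injective (s≤s (m≤n⇒m≤1+n t≤d)) ≤-refl eq)
    ; x-first      = step (s≤s z≤n)
    ; z-last       = E-sym (step ≤-refl)
    ; x-only-first = λ t≤d e → from-start (edge⇒consec z≤n (s≤s (m≤n⇒m≤1+n t≤d)) e)
    ; z-only-last  = λ t≤d e → to-end t≤d (edge⇒consec ≤-refl (s≤s (m≤n⇒m≤1+n t≤d)) e) }
    where
    open InducedPath p
    from-start : ∀ {t} → Consec G 0 (suc t) → t ≡ 0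
    from-start (inj₁ eq) = sym (suc-injective eq)
    to-end : ∀ {t} → t ≤ d → Consec G (2 + d) (suc t) → t ≡ d
    to-end t≤d (inj₁ eq) = ⊥-elim (<⇒≢ (s≤s (m≤n⇒m≤1+n t≤d)) (sym (suc-injective eq)))
    to-end t≤d (inj₂ eq) = suc-injective (suc-injective eq)

  ends-distinct : ∀ {A d} → InducedPath A (2 + d) → A 0 ≢ A (2 + d)
  ends-distinct p eq with InducedPath.injective p z≤n ≤-refl eq
  ... | ()

  ends-nonadjacent : ∀ {A d} → InducedPath A (2 + d) → ¬ E (A 0) (A (2 + d))
  ends-nonadjacent p e with InducedPath.edge⇒consec p z≤n ≤-refl e
  ... | inj₁ ()

  singleton-interior : ∀ {x z u} → u ≢ x → u ≢ z → E x u → E z u → InteriorPath x z (λ _ → u) 0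
  singleton-interior u≢x u≢z x-u z-u = record
    { path = singleton-inducedPath _ ; ≢x = λ _ → u≢x ; ≢z = λ _ → u≢z ; x-first = x-u ; z-last = z-u
    ; x-only-first = λ t≤0 _ → n≤0⇒n≡0 t≤0 ; z-only-last = λ t≤0 _ → n≤0⇒n≡0 t≤0 }

  pair : V G → V G → ℕ → V G
  pair u v zero    = u
  pair u v (suc _) = v

  pair-inducedPath : ∀ {u v} → E u v → InducedPath (pair u v) 1
  pair-inducedPath {u} {v} e = record { injective = inj ; edge⇒consec = adj ; step = λ { (s≤s z≤n) → e } }
    where
    inj : ∀ {i j} → i ≤ 1 → j ≤ 1 → pair u v i ≡ pair u v j → i ≡ j
    inj {zero}  {zero}  _         _         _  = refl
    inj {zero}  {suc _} _         _         eq = ⊥-elim (E-irr (subst (E u) (sym eq) e))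
    inj {suc _} {zero}  _         _         eq = ⊥-elim (E-irr (subst (E u) eq e))
    inj {suc _} {suc _} (s≤s z≤n) (s≤s z≤n) _  = refl
    adj : ∀ {i j} → i ≤ 1 → j ≤ 1 → E (pair u v i) (pair u v j) → Consec G i j
    adj {zero}  {zero}  _         _         e′ = ⊥-elim (E-irr e′)
    adj {zero}  {suc _} _         (s≤s z≤n) _  = inj₁ refl
    adj {suc _} {zero}  (s≤s z≤n) _         _  = inj₂ refl
    adj {suc _} {suc _} _         _         e′ = ⊥-elim (E-irr e′)

  edge-interior : ∀ {x z u v} → E u v → u ≢ x → u ≢ z → v ≢ x → v ≢ z →
    E x u → E z v → ¬ E x v → ¬ E z u → InteriorPath x z (pair u v) 1
  edge-interior {x} {z} {u} {v} e u≢x u≢z v≢x v≢z x-u z-v x≁v z≁u = record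
    { path = pair-inducedPath e ; ≢x = ≢x ; ≢z = ≢z ; x-first = x-u ; z-last = z-v
    ; x-only-first = x-only ; z-only-last = z-only }
    where
    ≢x : ∀ {t} → t ≤ 1 → pair u v t ≢ x
    ≢x {zero}  _ = u≢x
    ≢x {suc _} _ = v≢x
    ≢z : ∀ {t} → t ≤ 1 → pair u v t ≢ z
    ≢z {zero}  _ = u≢z
    ≢z {suc _} _ = v≢z
    x-only : ∀ {t} → t ≤ 1 → E x (pair u v t) → t ≡ 0
    x-only {zero}  _ _   = refl
    x-only {suc _} _ x-v = ⊥-elim (x≁v x-v)
    z-only : ∀ {t} → t ≤ 1 → E z (pair u v t) → t ≡ 1
    z-only {zero}        _ z-u = ⊥-elim (z≁u z-u)
    z-only {suc _} (s≤s z≤n) _ = refl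

  HoleWithin : (V G → Set) → ℕ → Set
  HoleWithin Pr len = Σ (Fin len → V G) λ H → IsHole G H × (∀ i → Pr (H i))

  module _ {x z : V G} {F F′ : ℕ → V G} {m m′ : ℕ} (I : InteriorPath x z F m) (I′ : InteriorPath x z F′ m′)
           (disjoint : ∀ {t t′} → t ≤ m → t′ ≤ m′ → F t ≢ F′ t′)
           (anticomplete : ∀ {t t′} → t ≤ m → t′ ≤ m′ → ¬ E (F t) (F′ t′)) where
    private
      module I  = InteriorPath I
      module I′ = InteriorPath I′

    F+z : ℕ → V G
    F+z = append F m (λ _ → z)

    F′-backwards : ℕ → V G
    F′-backwards t = F′ (m′ ∸ t)

    through-z : ℕ → V G
    through-z = append F+z (suc m + 0) F′-backwards

    data ThroughZ : ℕ → Set where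
      inF  : ∀ {t} → t ≤ m → through-z t ≡ F t → ThroughZ t
      atz  : ∀ {t} → through-z t ≡ z → ThroughZ t
      inF′ : ∀ t′ → through-z (suc (suc m + 0) + t′) ≡ F′ (m′ ∸ t′) → ThroughZ (suc (suc m + 0) + t′)

    through-z-view : ∀ t → ThroughZ t
    through-z-view t with append-view F+z (suc m + 0) F′-backwards t
    ... | right t′ refl eq = inF′ t′ eq
    ... | left _ eq with append-view F m (λ _ → z) t
    ...   | left t≤m eq′     = inF t≤m (trans eq eq′)
    ...   | right _ refl eq′ = atz (trans eq eq′)

    F+z-inducedPath : InducedPath F+z (suc m + 0)
    F+z-inducedPath = append-inducedPath F m (λ _ → z) I.path (singleton-inducedPath z) (E-sym I.z-last)
      (λ t≤m _ → I.≢z t≤m) (λ t≤m t′≤0 e → I.z-only-last t≤m (E-sym e) , n≤0⇒n≡0 t′≤0)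

    through-z-inducedPath : InducedPath through-z (suc (suc m + 0) + m′)
    through-z-inducedPath = append-inducedPath F+z (suc m + 0) F′-backwards
      F+z-inducedPath (reverse-inducedPath I′.path)
      (subst (λ w → E w (F′ m′)) (sym (append-right F m (λ _ → z) 0)) I′.z-last) F+z≢F′ F+z-F′
      where
      F+z≢F′ : ∀ {t t′} → t ≤ suc m + 0 → t′ ≤ m′ → F+z t ≢ F′ (m′ ∸ t′)
      F+z≢F′ {t} {t′} _ _ eq with append-view F m (λ _ → z) t
      ... | left t≤m e     = disjoint t≤m (m∸n≤m m′ t′) (trans (sym e) eq)
      ... | right _ refl e = I′.≢z (m∸n≤m m′ t′) (sym (trans (sym e) eq))
      F+z-F′ : ∀ {t t′} → t ≤ suc m + 0 → t′ ≤ m′ → E (F+z t) (F′ (m′ ∸ t′)) →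
               t ≡ suc m + 0 × t′ ≡ 0
      F+z-F′ {t} {t′} t≤ t′≤ e with append-view F m (λ _ → z) t
      ... | left t≤m eq     = ⊥-elim (anticomplete t≤m (m∸n≤m m′ t′) (subst (λ w → E w _) eq e))
      ... | right _ refl eq =
        cong (suc m +_) (n≤0⇒n≡0 (+-cancelˡ-≤ (suc m) _ _ t≤)) ,
        ∸-cancelˡ-≡ t′≤ z≤n (I′.z-only-last (m∸n≤m m′ t′) (subst (λ w → E w _) eq e))

    interiors⇒hole : x ≢ z → ¬ E x z →
      ∀ (Pr : V G → Set) → Pr x → Pr z →
      (∀ {t} → t ≤ m → Pr (F t)) → (∀ {t} → t ≤ m′ → Pr (F′ t)) →
      HoleWithin Pr (4 + (m + m′))
    interiors⇒hole x≢z x≁z Pr Pr-x Pr-z Pr-F Pr-F′ =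
      subst (HoleWithin Pr) (cong (λ t → 4 + (t + m′)) (+-identityʳ m))
        ( (λ i → cons x through-z (toℕ i))
        , cons-isHole through-z-inducedPath (s≤s (s≤s z≤n)) ≢x (subst (E x) (sym first) I.x-first)
            (subst (E x) (sym last) I′.x-first) x-only
        , λ i → Pr-cons (toℕ i) )
      where
      first : through-z 0 ≡ F 0
      first = trans (append-left F+z (suc m + 0) F′-backwards z≤n) (append-left F m (λ _ → z) z≤n)
      last : through-z (suc (suc m + 0) + m′) ≡ F′ 0
      last = trans (append-right F+z (suc m + 0) F′-backwards m′) (cong F′ (n∸n≡0 m′))
      ≢x : ∀ {t} → t ≤ suc (suc m + 0) + m′ → through-z t ≢ x
      ≢x {t} _ with through-z-view t
      ... | inF t≤m eq = λ eq′ → I.≢x t≤m (trans (sym eq) eq′)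
      ... | atz eq     = λ eq′ → x≢z (trans (sym eq′) eq)
      ... | inF′ t′ eq = λ eq′ → I′.≢x (m∸n≤m m′ t′) (trans (sym eq) eq′)
      x-only : ∀ {t} → t ≤ suc (suc m + 0) + m′ → E x (through-z t) → t ≡ 0 ⊎ t ≡ suc (suc m + 0) + m′
      x-only {t} t≤n e with through-z-view t
      ... | inF t≤m eq = inj₁ (I.x-only-first t≤m (subst (E x) eq e))
      ... | atz eq     = ⊥-elim (x≁z (subst (E x) eq e))
      ... | inF′ t′ eq = inj₂ (cong (suc (suc m + 0) +_) (≤-antisym
                           (+-cancelˡ-≤ (suc (suc m + 0)) _ _ t≤n)
                           (m∸n≡0⇒m≤n (I′.x-only-first (m∸n≤m m′ t′) (subst (E x) eq e)))))
      Pr-cons : ∀ t → Pr (cons x through-z t)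
      Pr-cons zero = Pr-x
      Pr-cons (suc t) with through-z-view t
      ... | inF t≤m eq = subst Pr (sym eq) (Pr-F t≤m)
      ... | atz eq     = subst Pr (sym eq) Pr-z
      ... | inF′ t′ eq = subst Pr (sym eq) (Pr-F′ (m∸n≤m m′ t′))

  record MinimalSegment (X Z : V G → Set) (R : ℕ → V G) (n : ℕ) : Set where
    field
      f            : ℕ → V G
      m            : ℕ
      path         : InducedPath f m
      within       : ∀ {t} → t ≤ m → ∃ λ t′ → t′ ≤ n × f t ≡ R t′
      X-start      : X (f 0)
      X-only-start : ∀ {t} → t ≤ m → X (f t) → t ≡ 0
      Z-end        : Z (f m)
      Z-only-end   : ∀ {t} → t ≤ m → Z (f t) → t ≡ m

  module _ {X Z : V G → Set} (X? : Decidable X) (Z? : Decidable Z) where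

    minimalSegment-forward : ∀ {R n ta tb} → InducedPath R n → ta ≤ tb → tb ≤ n →
                             X (R ta) → Z (R tb) → MinimalSegment X Z R n
    minimalSegment-forward {R} {n} {ta} {tb} p ta≤tb tb≤n X-ta Z-tb = segment (m≤n⇒∃[o]m+o≡n B.i≤b)
      where
      module A = GreatestBelow (greatestBelow (X? ∘ R) X-ta (s≤s ta≤tb))
      module B = LeastAbove (leastAbove (Z? ∘ R) Z-tb (s≤s⁻¹ A.a<n))
      segment : (∃ λ d → A.a + d ≡ B.b) → MinimalSegment X Z R n
      segment (d , a+d≡b) = record
        { f = λ t → R (A.a + t) ; m = d
        ; path = drop-inducedPath A.a a+d≤n p
        ; within = λ {t} t≤d → A.a + t , ≤-trans (+-monoʳ-≤ A.a t≤d) a+d≤n , refl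
        ; X-start = subst (X ∘ R) (sym (+-identityʳ A.a)) A.holds
        ; X-only-start = X-only
        ; Z-end = subst (Z ∘ R) (sym a+d≡b) B.holds
        ; Z-only-end = Z-only }
        where
        a+d≤n : A.a + d ≤ n
        a+d≤n = subst (_≤ n) (sym a+d≡b) (≤-trans B.b≤j tb≤n)
        X-only : ∀ {t} → t ≤ d → X (R (A.a + t)) → t ≡ 0
        X-only {zero}  _   _ = refl
        X-only {suc t} t≤d X-t = ⊥-elim (A.beyond (m<m+n A.a (s≤s z≤n))
          (s≤s (≤-trans (+-monoʳ-≤ A.a t≤d) (≤-trans (≤-reflexive a+d≡b) B.b≤j))) X-t)
        Z-only : ∀ {t} → t ≤ d → Z (R (A.a + t)) → t ≡ d
        Z-only {t} t≤d Z-t with m≤n⇒m<n∨m≡n t≤d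
        ... | inj₂ t≡d = t≡d
        ... | inj₁ t<d = ⊥-elim (B.before (m≤m+n A.a t) (subst (A.a + t <_) a+d≡b (+-monoʳ-< A.a t<d)) Z-t)

    minimalSegment : ∀ {R n ta tb} → InducedPath R n → ta ≤ n → tb ≤ n →
                     X (R ta) → Z (R tb) → MinimalSegment X Z R n
    minimalSegment {R} {n} {ta} {tb} p ta≤n tb≤n X-ta Z-tb with ≤-total ta tb
    ... | inj₁ ta≤tb = minimalSegment-forward p ta≤tb tb≤n X-ta Z-tb
    ... | inj₂ tb≤ta = record
      { f = S.f ; m = S.m ; path = S.path ; within = λ t≤m → back (S.within t≤m)
      ; X-start = S.X-start ; X-only-start = S.X-only-start ; Z-end = S.Z-end ; Z-only-end = S.Z-only-end }
      where
      S : MinimalSegment X Z (λ t → R (n ∸ t)) n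
      S = minimalSegment-forward (reverse-inducedPath p) (∸-monoʳ-≤ n tb≤ta) (m∸n≤m n tb)
            (subst (X ∘ R) (sym (m∸[m∸n]≡n ta≤n)) X-ta) (subst (Z ∘ R) (sym (m∸[m∸n]≡n tb≤n)) Z-tb)
      module S = MinimalSegment S
      back : ∀ {w} → (∃ λ t′ → t′ ≤ n × w ≡ R (n ∸ t′)) → ∃ λ t′ → t′ ≤ n × w ≡ R t′
      back (t′ , _ , eq) = n ∸ t′ , m∸n≤m n t′ , eq

  fin-inducedPath : ∀ {p} {P : Fin (suc p) → V G} → IsInducedPath G P → InducedPath (λ t → P (t mod suc p)) p
  fin-inducedPath {p} {P} (P-injective , P-edge) = record
    { injective   = λ i≤p j≤p eq →
        trans (sym (toℕ-mod i≤p)) (trans (cong toℕ (P-injective eq)) (toℕ-mod j≤p))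
    ; edge⇒consec = λ i≤p j≤p e →
        subst₂ (Consec G) (toℕ-mod i≤p) (toℕ-mod j≤p) (Equivalence.to (P-edge _ _) e)
    ; step        = λ i<p → Equivalence.from (P-edge _ _)
        (inj₁ (trans (cong suc (toℕ-mod (<⇒≤ i<p))) (sym (toℕ-mod i<p)))) }
    where
    toℕ-mod : ∀ {t} → t ≤ p → toℕ (t mod suc p) ≡ t
    toℕ-mod t≤p = trans (toℕ-fromℕ< _) (m<n⇒m%n≡m (s≤s t≤p))

module _ {L : ℕ} .{{_ : NonZero L}} where

  [m+n]%L≡[m%L+n]%L : ∀ m n → (m + n) % L ≡ (m % L + n) % L
  [m+n]%L≡[m%L+n]%L m n = begin
    (m + n) % L                 ≡⟨ cong (λ t → (t + n) % L) (m≡m%n+[m/n]*n m L) ⟩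
    (m % L + m / L * L + n) % L ≡⟨ cong (_% L) (+-assoc (m % L) _ n) ⟩
    (m % L + (m / L * L + n)) % L ≡⟨ cong (λ t → (m % L + t) % L) (+-comm (m / L * L) n) ⟩
    (m % L + (n + m / L * L)) % L ≡⟨ cong (_% L) (+-assoc (m % L) n _) ⟨
    (m % L + n + m / L * L) % L ≡⟨ [m+kn]%n≡m%n (m % L + n) (m / L) L ⟩
    (m % L + n) % L             ∎
    where open ≡-Reasoning

  [1+m]%L≡[1+m%L]%L : ∀ m → suc m % L ≡ suc (m % L) % L
  [1+m]%L≡[1+m%L]%L m = begin
    suc m % L       ≡⟨ cong (_% L) (+-comm 1 m) ⟩
    (m + 1) % L     ≡⟨ [m+n]%L≡[m%L+n]%L m 1 ⟩
    (m % L + 1) % L ≡⟨ cong (_% L) (+-comm (m % L) 1) ⟩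
    suc (m % L) % L ∎
    where open ≡-Reasoning

  %-shift-fixed⇒0 : ∀ w {e} → e < L → (w + e) % L ≡ w % L → e ≡ 0
  %-shift-fixed⇒0 w {e} e<L eq with w % L + e <? L
  ... | yes ρ+e<L = +-cancelˡ-≡ (w % L) e 0 (begin
    w % L + e       ≡⟨ m<n⇒m%n≡m ρ+e<L ⟨
    (w % L + e) % L ≡⟨ [m+n]%L≡[m%L+n]%L w e ⟨
    (w + e) % L     ≡⟨ eq ⟩
    w % L           ≡⟨ +-identityʳ (w % L) ⟨
    w % L + 0       ∎)
    where open ≡-Reasoning
  ... | no  ρ+e≮L = ⊥-elim (<⇒≢ e<L (sym (+-cancelˡ-≡ (w % L) L e (begin
    w % L + L           ≡⟨ cong (_+ L) reduced ⟨
    w % L + e ∸ L + L   ≡⟨ m∸n+n≡m (≮⇒≥ ρ+e≮L) ⟩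
    w % L + e           ∎))))
    where
    open ≡-Reasoning
    reduced : w % L + e ∸ L ≡ w % L
    reduced = begin
      w % L + e ∸ L         ≡⟨ m<n⇒m%n≡m (m<n+o⇒m∸n<o _ L (+-mono-< (m%n<n w L) e<L)) ⟨
      (w % L + e ∸ L) % L   ≡⟨ m≤n⇒[n∸m]%m≡n%m (≮⇒≥ ρ+e≮L) ⟩
      (w % L + e) % L       ≡⟨ [m+n]%L≡[m%L+n]%L w e ⟨
      (w + e) % L           ≡⟨ eq ⟩
      w % L                 ∎

  %-window-≤ : ∀ s {a b} → a ≤ b → b < L → (s + b) % L ≡ (s + a) % L → b ≡ a
  %-window-≤ s {a} a≤b b<L eq with m≤n⇒∃[o]m+o≡n a≤b
  ... | e , refl = trans (cong (a +_) (%-shift-fixed⇒0 (s + a) (≤-<-trans (m≤n+m e a) b<L)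
                     (trans (cong (_% L) (+-assoc s a e)) eq))) (+-identityʳ a)

  %-window-injective : ∀ s {i j} → i < L → j < L → (s + i) % L ≡ (s + j) % L → i ≡ j
  %-window-injective s {i} {j} i<L j<L eq with ≤-total i j
  ... | inj₁ i≤j = sym (%-window-≤ s i≤j j<L (sym eq))
  ... | inj₂ j≤i = %-window-≤ s j≤i i<L eq

module Around (G : Graph) {L : ℕ} .{{_ : NonZero L}} (C : Fin L → V G) (hole : IsHole G C) where
  open Graph G using (E)
  open Paths G

  around : ℕ → V G
  around t = C (t mod L)

  toℕ-mod : ∀ t → toℕ (t mod L) ≡ t % L
  toℕ-mod t = toℕ-fromℕ< (m%n<n t L)

  around-cong : ∀ {s t} → s % L ≡ t % L → around s ≡ around t
  around-cong {s} {t} eq = cong C (toℕ-injective (trans (toℕ-mod s) (trans eq (sym (toℕ-mod t)))))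

  around-injective : ∀ {s t} → around s ≡ around t → s % L ≡ t % L
  around-injective {s} {t} eq =
    trans (sym (toℕ-mod s)) (trans (cong toℕ (proj₁ (proj₂ hole) eq)) (toℕ-mod t))

  around-toℕ : ∀ i → around (toℕ i) ≡ C i
  around-toℕ i = cong C (toℕ-injective (trans (toℕ-mod (toℕ i)) (m<n⇒m%n≡m (toℕ<n i))))

  around-periodic : ∀ t → around (L + t) ≡ around t
  around-periodic t = around-cong (trans (cong (_% L) (+-comm L t)) ([m+n]%n≡m%n t L))

  cycSucc⇒% : ∀ {p q} → q < L → suc p ≡ q ⊎ (suc p ≡ L × q ≡ 0) → suc p % L ≡ q
  cycSucc⇒% q<L (inj₁ refl)        = m<n⇒m%n≡m q<L
  cycSucc⇒% _   (inj₂ (eq , refl)) = trans (cong (_% L) eq) (n%n≡0 L)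

  %⇒cycSucc : ∀ {p q} → p < L → suc p % L ≡ q → suc p ≡ q ⊎ (suc p ≡ L × q ≡ 0)
  %⇒cycSucc p<L refl with m≤n⇒m<n∨m≡n p<L
  ... | inj₁ 1+p<L = inj₁ (sym (m<n⇒m%n≡m 1+p<L))
  ... | inj₂ 1+p≡L = inj₂ (1+p≡L , trans (cong (_% L) 1+p≡L) (n%n≡0 L))

  around-adjacent⇒ : ∀ {a b} → E (around a) (around b) → suc a % L ≡ b % L ⊎ suc b % L ≡ a % L
  around-adjacent⇒ {a} {b} e =
    succ (subst₂ (CycConsec G L) (toℕ-mod a) (toℕ-mod b) (Equivalence.to (proj₂ (proj₂ hole) _ _) e))
    where
    succ : CycConsec G L (a % L) (b % L) → suc a % L ≡ b % L ⊎ suc b % L ≡ a % L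
    succ (inj₁ (inj₁ eq)) = inj₁ (trans ([1+m]%L≡[1+m%L]%L a) (cycSucc⇒% (m%n<n b L) (inj₁ eq)))
    succ (inj₁ (inj₂ eq)) = inj₂ (trans ([1+m]%L≡[1+m%L]%L b) (cycSucc⇒% (m%n<n a L) (inj₁ eq)))
    succ (inj₂ (inj₁ (a%L≡0 , eq))) =
      inj₂ (trans ([1+m]%L≡[1+m%L]%L b) (cycSucc⇒% (m%n<n a L) (inj₂ (eq , a%L≡0))))
    succ (inj₂ (inj₂ (b%L≡0 , eq))) =
      inj₁ (trans ([1+m]%L≡[1+m%L]%L a) (cycSucc⇒% (m%n<n b L) (inj₂ (eq , b%L≡0))))

  succ⇒around-adjacent : ∀ {a b} → suc a % L ≡ b % L → E (around a) (around b)
  succ⇒around-adjacent {a} {b} eq =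
    Equivalence.from (proj₂ (proj₂ hole) _ _)
      (subst₂ (CycConsec G L) (sym (toℕ-mod a)) (sym (toℕ-mod b))
        (cycConsec (%⇒cycSucc (m%n<n a L) (trans (sym ([1+m]%L≡[1+m%L]%L a)) eq))))
    where
    cycConsec : suc (a % L) ≡ b % L ⊎ (suc (a % L) ≡ L × b % L ≡ 0) → CycConsec G L (a % L) (b % L)
    cycConsec (inj₁ eq′)         = inj₁ (inj₁ eq′)
    cycConsec (inj₂ (eq′ , b%L≡0)) = inj₂ (inj₂ (b%L≡0 , eq′))

  around-suc : ∀ {t i j} → around t ≡ C i → CycSucc G L i j → around (suc t) ≡ C j
  around-suc {t} {i} {j} eq i→j = trans (around-cong (begin
    suc t % L          ≡⟨ [1+m]%L≡[1+m%L]%L t ⟩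
    suc (t % L) % L    ≡⟨ cong (λ r → suc r % L) t%L≡i ⟩
    suc (toℕ i) % L    ≡⟨ cycSucc⇒% (toℕ<n j) i→j ⟩
    toℕ j              ≡⟨ m<n⇒m%n≡m (toℕ<n j) ⟨
    toℕ j % L          ∎)) (around-toℕ j)
    where
    open ≡-Reasoning
    t%L≡i : t % L ≡ toℕ i
    t%L≡i = trans (around-injective (trans eq (sym (around-toℕ i)))) (m<n⇒m%n≡m (toℕ<n i))

  around-arc : ∀ s d → 2 + d ≤ L → InducedPath (λ t → around (s + t)) d
  around-arc s d 2+d≤L = record
    { injective   = λ i≤d j≤d eq → %-window-injective s (<L i≤d) (<L j≤d) (around-injective eq)
    ; edge⇒consec = λ i≤d j≤d e → consec i≤d j≤d (around-adjacent⇒ e)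
    ; step        = λ {i} _ → succ⇒around-adjacent (cong (_% L) (sym (+-suc s i))) }
    where
    1+<L : ∀ {t} → t ≤ d → suc t < L
    1+<L t≤d = <-≤-trans (s≤s (s≤s t≤d)) 2+d≤L
    <L : ∀ {t} → t ≤ d → t < L
    <L t≤d = <-trans (n<1+n _) (1+<L t≤d)
    consec : ∀ {i j} → i ≤ d → j ≤ d →
             suc (s + i) % L ≡ (s + j) % L ⊎ suc (s + j) % L ≡ (s + i) % L → Consec G i j
    consec {i} i≤d j≤d (inj₁ eq) =
      inj₁ (%-window-injective s (1+<L i≤d) (<L j≤d) (trans (cong (_% L) (+-suc s i)) eq))
    consec {j = j} i≤d j≤d (inj₂ eq) =
      inj₂ (%-window-injective s (1+<L j≤d) (<L i≤d) (trans (cong (_% L) (+-suc s j)) eq))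

≤-squeeze : ∀ {L a b a₀ b₀} β →
  L + a ≤ β + b → b ≤ b₀ → L + b₀ ≤ β + (L + a₀) → a₀ ≤ a → L ≤ β + β
≤-squeeze {L} {a} {b} {a₀} {b₀} β hole₁ b≤b₀ hole₂ a₀≤a = +-cancelʳ-≤ a L (β + β) (begin
  L + a         ≤⟨ hole₁ ⟩
  β + b         ≤⟨ +-monoʳ-≤ β b≤b₀ ⟩
  β + b₀        ≤⟨ +-monoʳ-≤ β b₀≤β+a₀ ⟩
  β + (β + a₀)  ≤⟨ +-monoʳ-≤ β (+-monoʳ-≤ β a₀≤a) ⟩
  β + (β + a)   ≡⟨ +-assoc β β a ⟨
  β + β + a     ∎)
  where
  open ≤-Reasoning
  b₀≤β+a₀ : b₀ ≤ β + a₀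
  b₀≤β+a₀ = +-cancelˡ-≤ L b₀ (β + a₀) (≤-trans hole₂ (≤-reflexive (x∙yz≈y∙xz β L a₀)))

module Decidability (G : Graph) {L : ℕ} (C : Fin L → V G) where
  open Graph G using (E-dec)

  ∈C? : ∀ u → Dec (_∈V_ G u C)
  ∈C? u = any? (λ i → C i Fin.≟ u)

  InD? : ∀ u → Dec (InD G C u)
  InD? u = all? (λ i → E-dec u (C i))

  InZ? : ∀ v u → Dec (InZ G C v u)
  InZ? v u = (u Fin.≟ v) ⊎-dec (E-dec v u ×-dec (¬? (∈C? u) ×-dec ¬? (InD? u)))

  InSp? : ∀ {m} (P : Fin m → V G) v → Dec (InSp G C P v)
  InSp? P v = ∈C? v ×-dec any? (λ i → InZ? v (P i) ⊎-dec InD? (P i))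

module Cut (G : Graph) {L : ℕ} .{{_ : NonZero L}} (C : Fin L → V G)
           (shortest : IsShortestHole G C) (7≤L : 7 ≤ L) (cut : Fin L) where
  open Graph G using (E; E-dec; E-sym)
  open Paths G
  open Around G C (proj₁ shortest)
  open Decidability G C using (∈C?)

  OnC : V G → Set
  OnC u = _∈V_ G u C

  c : ℕ → V G
  c t = around (toℕ cut + t)

  c-arc : ∀ s d → 2 + d ≤ L → InducedPath (λ t → c (s + t)) d
  c-arc s d 2+d≤L =
    inducedPath-cong (λ t → cong around (+-assoc (toℕ cut) s t)) (around-arc (toℕ cut + s) d 2+d≤L)

  c-periodic : ∀ t → c (L + t) ≡ c t
  c-periodic t = trans (cong around (x∙yz≈y∙xz (toℕ cut) L t)) (around-periodic (toℕ cut + t))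

  c-start : c 0 ≡ C cut
  c-start = trans (cong around (+-identityʳ (toℕ cut))) (around-toℕ cut)

  c-position : ∀ i → ∃ λ p → p < L × c p ≡ C i
  c-position i with toℕ cut ≤? toℕ i
  ... | yes κ≤i = toℕ i ∸ toℕ cut , ≤-<-trans (m∸n≤m (toℕ i) (toℕ cut)) (toℕ<n i) ,
                  trans (cong around (m+[n∸m]≡n κ≤i)) (around-toℕ i)
  ... | no  κ≰i = L ∸ toℕ cut + toℕ i ,
                  subst (L ∸ toℕ cut + toℕ i <_) (m∸n+n≡m κ≤L) (+-monoʳ-< (L ∸ toℕ cut) (≰⇒> κ≰i)) ,
                  trans (cong around κ+p≡L+i) (trans (around-periodic (toℕ i)) (around-toℕ i))
    where
    κ≤L : toℕ cut ≤ L
    κ≤L = <⇒≤ (toℕ<n cut)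
    κ+p≡L+i : toℕ cut + (L ∸ toℕ cut + toℕ i) ≡ L + toℕ i
    κ+p≡L+i = trans (sym (+-assoc (toℕ cut) _ (toℕ i))) (cong (_+ toℕ i) (m+[n∸m]≡n κ≤L))

  c-suc : ∀ {t i j} → c t ≡ C i → CycSucc G L i j → c (suc t) ≡ C j
  c-suc {t} eq i→j = trans (cong around (+-suc (toℕ cut) t)) (around-suc eq i→j)

  c-onC : ∀ t → OnC (c t)
  c-onC t = (toℕ cut + t) mod L , refl

  ∉C⇒≢c : ∀ {u} → ¬ OnC u → ∀ {t} → u ≢ c t
  ∉C⇒≢c u∉C {t} refl = u∉C (c-onC t)

  c-injective : ∀ {p q} → p < L → q < L → c p ≡ c q → p ≡ q
  c-injective p<L q<L eq = %-window-injective (toℕ cut) p<L q<L (around-injective eq)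

  c-nonadjacent : ∀ {p q} → 0 < p → 2 + p ≤ q → q < L → ¬ E (c p) (c q)
  c-nonadjacent {p} 0<p 2+p≤q q<L e with m≤n⇒∃[o]m+o≡n (≤-trans (n≤1+n p) (<⇒≤ 2+p≤q))
  ... | d , refl = not-consecutive (InducedPath.edge⇒consec (c-arc p d 2+d≤L) z≤n ≤-refl e′)
    where
    2+d≤L : 2 + d ≤ L
    2+d≤L = ≤-trans (s≤s (+-monoˡ-≤ d 0<p)) q<L
    e′ : E (c (p + 0)) (c (p + d))
    e′ = subst (λ w → E w (c (p + d))) (cong c (sym (+-identityʳ p))) e
    not-consecutive : ¬ Consec G 0 d
    not-consecutive (inj₁ refl) = <⇒≱ 2+p≤q (≤-reflexive (+-comm p 1))

  bridge : ∀ {W w a b} → 2 + a ≤ b → InteriorPath (c a) (c b) W w →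
           (∀ {t} → t ≤ w → ¬ OnC (W t)) →
           (∀ {t s} → t ≤ w → a < s → s < b → ¬ E (c s) (W t)) →
           L + a ≤ 2 + (w + b)
  bridge {W} {w} {a} 2+a≤b I W∉C anticomplete with m≤n⇒∃[o]m+o≡n 2+a≤b
  ... | d , refl = ≤-trans (+-monoˡ-≤ a (hole-length (4 + d ≤? L))) (≤-reflexive (arith w d a))
    where
    arith : ∀ w d a → 4 + (w + d) + a ≡ 2 + (w + (2 + a + d))
    arith = solve-∀
    a+[2+d]≡2+a+d : a + (2 + d) ≡ 2 + a + d
    a+[2+d]≡2+a+d = trans (+-suc a (suc d)) (cong suc (+-suc a d))
    hole-length : Dec (4 + d ≤ L) → L ≤ 4 + (w + d)
    -- An arc too long to be induced makes the bound trivial.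
    hole-length (no 4+d≰L)  = ≤-trans (s≤s⁻¹ (≰⇒> 4+d≰L)) (+-monoʳ-≤ 3 (≤-trans (m≤n+m d w) (n≤1+n (w + d))))
    hole-length (yes 4+d≤L) = proj₂ shortest _ (proj₁ (proj₂ hole))
      where
      arc : InducedPath (λ t → c (a + t)) (2 + d)
      arc = c-arc a (2 + d) 4+d≤L
      first : c (a + 0) ≡ c a
      first = cong c (+-identityʳ a)
      last : c (a + (2 + d)) ≡ c (2 + a + d)
      last = cong c a+[2+d]≡2+a+d
      inner : ∀ {t} → t ≤ d → a < a + suc t × a + suc t < 2 + a + d
      inner {t} t≤d = m<m+n a (s≤s z≤n) , subst (a + suc t <_) a+[2+d]≡2+a+d (+-monoʳ-< a (s≤s (s≤s t≤d)))
      hole : HoleWithin (λ _ → ⊤) (4 + (w + d))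
      hole = interiors⇒hole I
        (subst₂ (λ x z → InteriorPath x z (λ t → c (a + suc t)) d) first last (inner-interior arc))
        (λ t≤w _ → ∉C⇒≢c (W∉C t≤w))
        (λ t≤w t′≤d e → anticomplete t≤w (proj₁ (inner t′≤d)) (proj₂ (inner t′≤d)) (E-sym e))
        (λ eq → ends-distinct arc (trans first (trans eq (sym last))))
        (λ e → ends-nonadjacent arc (subst₂ E (sym first) (sym last) e))
        (λ _ → ⊤) tt tt (λ _ → tt) (λ _ → tt)

  vertex-bridge : ∀ {u a b} → ¬ OnC u → E (c a) u → E (c b) u → 2 + a ≤ b →
                  (∀ {s} → a < s → s < b → ¬ E (c s) u) → L + a ≤ 2 + b
  vertex-bridge u∉C a-u b-u 2+a≤b gap =
    bridge 2+a≤b (singleton-interior (∉C⇒≢c u∉C) (∉C⇒≢c u∉C) a-u b-u) (λ _ → u∉C) (λ _ → gap)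

  edge-bridge : ∀ {u v a b} → ¬ OnC u → ¬ OnC v → E u v → E (c a) u → E (c b) v →
                ¬ E (c a) v → ¬ E (c b) u → 2 + a ≤ b →
                (∀ {s} → a < s → s < b → ¬ E (c s) u × ¬ E (c s) v) → L + a ≤ 3 + b
  edge-bridge {u} {v} u∉C v∉C u-v a-u b-v a≁v b≁u 2+a≤b gap =
    bridge 2+a≤b
      (edge-interior u-v (∉C⇒≢c u∉C) (∉C⇒≢c u∉C) (∉C⇒≢c v∉C) (∉C⇒≢c v∉C) a-u b-v a≁v b≁u)
      pair∉C pair-gap
    where
    pair∉C : ∀ {t} → t ≤ 1 → ¬ OnC (pair u v t)
    pair∉C {zero}  _ = u∉C
    pair∉C {suc _} _ = v∉C
    pair-gap : ∀ {t s} → t ≤ 1 → _ < s → s < _ → ¬ E (c s) (pair u v t)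
    pair-gap {zero}  _ a<s s<b = proj₁ (gap a<s s<b)
    pair-gap {suc _} _ a<s s<b = proj₂ (gap a<s s<b)

  across-cut : ∀ (Pr : V G → Set) {w a} →
               (∀ {s} → w < s → s < L → Pr (c s)) → (∀ {s} → s < a → Pr (c s)) →
               ∀ {s} → w < s → s < L + a → Pr (c s)
  across-cut Pr before-cut after-cut {s} w<s s<L+a with s <? L
  ... | yes s<L = before-cut w<s s<L
  ... | no  s≮L with m≤n⇒∃[o]m+o≡n (≮⇒≥ s≮L)
  ...   | s′ , refl = subst Pr (sym (c-periodic s′)) (after-cut (+-cancelˡ-< L _ _ s<L+a))

  nbr? : ∀ u → Decidable (λ s → E (c s) u)
  nbr? u s = E-dec (c s) u

  -- The neighbours a < k < b of u nearest to k and its extreme neighbours a₀ ≤ a, b ≤ b₀ bridge two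
  -- holes, one across the gap at k and one through the cut; both have length at least L.
  neighbours-interval : ∀ {u i k j} → ¬ OnC u → ¬ E (c 0) u → E (c i) u → E (c j) u →
                        i < k → k < j → j < L → E (c k) u
  neighbours-interval {u} {i} {k} {j} u∉C 0≁u i-u j-u i<k k<j j<L with E-dec (c k) u
  ... | yes k-u = k-u
  ... | no  k≁u = ⊥-elim (<⇒≱ 7≤L (≤-trans L≤4 (m≤m+n 4 2)))
    where
    module A  = GreatestBelow (greatestBelow (nbr? u) i-u i<k)
    module B  = LeastAbove (leastAbove (nbr? u) j-u k<j)
    module A₀ = LeastAbove (leastAbove (nbr? u) i-u z≤n)
    module B₀ = GreatestBelow (greatestBelow (nbr? u) j-u j<L)
    0<a₀ : 0 < A₀.b
    0<a₀ with A₀.b | A₀.holds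
    ... | zero  | 0-u = ⊥-elim (0≁u 0-u)
    ... | suc _ | _   = s≤s z≤n
    hole₁ : L + A.a ≤ 2 + B.b
    hole₁ = vertex-bridge u∉C A.holds B.holds (≤-trans (s≤s A.a<n) B.i≤b) gap
      where
      gap : ∀ {s} → A.a < s → s < B.b → ¬ E (c s) u
      gap {s} a<s s<b with <-cmp s k
      ... | tri< s<k _ _ = A.beyond a<s s<k
      ... | tri≈ _ refl _ = k≁u
      ... | tri> _ _ k<s = B.before k<s s<b
    hole₂ : L + B₀.a ≤ 2 + (L + A₀.b)
    hole₂ = vertex-bridge u∉C B₀.holds (subst (λ w → E w u) (sym (c-periodic A₀.b)) A₀.holds)
      (subst (_≤ L + A₀.b) (+-comm (suc B₀.a) 1) (+-mono-≤ B₀.a<n 0<a₀))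
      (across-cut (λ w → ¬ E w u) B₀.beyond (A₀.before z≤n))
    L≤4 : L ≤ 2 + 2
    L≤4 = ≤-squeeze 2 hole₁ (≤-trans B.b≤j B₀.i≤a) hole₂ (≤-trans A₀.b≤j A.i≤a)

  -- As in neighbours-interval, with the edge uv bridging both holes.
  edge-separation : ∀ {u v i k j} → ¬ OnC u → ¬ OnC v → E u v → ¬ E (c 0) u → ¬ E (c 0) v →
    E (c i) u → E (c j) v → i < k → k < j → j < L → ¬ E (c k) u → ¬ E (c k) v → ⊥
  edge-separation {u} {v} {i} {k} {j} u∉C v∉C u-v 0≁u 0≁v i-u j-v i<k k<j j<L k≁u k≁v = <⇒≱ 7≤L L≤6
    where
    u-before : ∀ {s} → k ≤ s → s < L → ¬ E (c s) u
    u-before k≤s s<L s-u with m≤n⇒m<n∨m≡n k≤s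
    ... | inj₁ k<s  = k≁u (neighbours-interval u∉C 0≁u i-u s-u i<k k<s s<L)
    ... | inj₂ refl = k≁u s-u
    v-after : ∀ {s} → s ≤ k → ¬ E (c s) v
    v-after s≤k s-v with m≤n⇒m<n∨m≡n s≤k
    ... | inj₁ s<k  = k≁v (neighbours-interval v∉C 0≁v s-v j-v s<k k<j j<L)
    ... | inj₂ refl = k≁v s-v
    module A  = GreatestBelow (greatestBelow (nbr? u) i-u i<k)
    module B  = LeastAbove (leastAbove (nbr? v) j-v k<j)
    module A₀ = LeastAbove (leastAbove (nbr? u) i-u z≤n)
    module B₀ = GreatestBelow (greatestBelow (nbr? v) j-v j<L)
    0<a₀ : 0 < A₀.b
    0<a₀ with A₀.b | A₀.holds
    ... | zero  | 0-u = ⊥-elim (0≁u 0-u)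
    ... | suc _ | _   = s≤s z≤n
    hole₁ : L + A.a ≤ 3 + B.b
    hole₁ = edge-bridge u∉C v∉C u-v A.holds B.holds (v-after (<⇒≤ A.a<n))
      (u-before (<⇒≤ B.i≤b) (≤-<-trans B.b≤j j<L)) (≤-trans (s≤s A.a<n) B.i≤b) gap
      where
      gap : ∀ {s} → A.a < s → s < B.b → ¬ E (c s) u × ¬ E (c s) v
      gap {s} a<s s<b with <-cmp s k
      ... | tri< s<k _ _  = A.beyond a<s s<k , v-after (<⇒≤ s<k)
      ... | tri≈ _ refl _ = k≁u , k≁v
      ... | tri> _ _ k<s  = u-before (<⇒≤ k<s) (<-trans s<b (≤-<-trans B.b≤j j<L)) , B.before k<s s<b
    hole₂ : L + B₀.a ≤ 3 + (L + A₀.b)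
    hole₂ = edge-bridge v∉C u∉C (E-sym u-v) B₀.holds (subst (λ w → E w u) (sym (c-periodic A₀.b)) A₀.holds)
      (u-before (≤-trans (<⇒≤ k<j) B₀.i≤a) B₀.a<n)
      (subst (λ w → ¬ E w v) (sym (c-periodic A₀.b)) (v-after (≤-trans A₀.b≤j (<⇒≤ i<k))))
      (subst (_≤ L + A₀.b) (+-comm (suc B₀.a) 1) (+-mono-≤ B₀.a<n 0<a₀))
      (across-cut (λ w → ¬ E w v × ¬ E w u)
        (λ b₀<s s<L → B₀.beyond b₀<s s<L , u-before (≤-trans (<⇒≤ k<j) (≤-trans B₀.i≤a (<⇒≤ b₀<s))) s<L)
        (λ s<a₀ → v-after (≤-trans (<⇒≤ s<a₀) (≤-trans A₀.b≤j (<⇒≤ i<k))) , A₀.before z≤n s<a₀))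
    L≤6 : L ≤ 3 + 3
    L≤6 = ≤-squeeze 3 hole₁ (≤-trans B.b≤j B₀.i≤a) hole₂ (≤-trans A₀.b≤j A.i≤a)

  Attach : V G → ℕ → Set
  Attach u p = InZ G C (c p) u

  attach-onC : ∀ {u p} → OnC u → Attach u p → u ≡ c p
  attach-onC _   (inj₁ eq)             = eq
  attach-onC u∈C (inj₂ (_ , u∉C , _)) = ⊥-elim (u∉C u∈C)

  attach-offC : ∀ {u p} → ¬ OnC u → Attach u p → E (c p) u
  attach-offC u∉C (inj₁ refl)    = ⊥-elim (u∉C (c-onC _))
  attach-offC _   (inj₂ (e , _)) = e

  attach : ∀ {u p} → ¬ OnC u → ¬ InD G C u → E (c p) u → Attach u p
  attach u∉C u∉D e = inj₂ (e , u∉C , u∉D)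

  attach-positive : ∀ {u p} → ¬ Attach u 0 → Attach u p → 0 < p
  attach-positive {p = zero}  u≁0 u-p = ⊥-elim (u≁0 u-p)
  attach-positive {p = suc _} _   _   = s≤s z≤n

  attach-convex : ∀ {u p k q} → ¬ InD G C u → ¬ Attach u 0 → p < k → k < q → q < L →
                  Attach u p → Attach u q → Attach u k
  attach-convex {u} u∉D u≁0 p<k k<q q<L u-p u-q with ∈C? u
  ... | yes u∈C = ⊥-elim (<⇒≢ (<-trans p<k k<q)
                    (c-injective (<-trans p<k (<-trans k<q q<L)) q<L
                      (trans (sym (attach-onC u∈C u-p)) (attach-onC u∈C u-q))))
  ... | no  u∉C = attach u∉C u∉D (neighbours-interval u∉C (u≁0 ∘ attach u∉C u∉D)
                    (attach-offC u∉C u-p) (attach-offC u∉C u-q) p<k k<q q<L)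

  attach-cross : ∀ {u v p k q} → E u v → ¬ InD G C u → ¬ InD G C v → ¬ Attach u 0 → ¬ Attach v 0 →
                 p < k → k < q → q < L → Attach u p → Attach v q → Attach u k ⊎ Attach v k
  attach-cross {u} {v} {k = k} u-v u∉D v∉D u≁0 v≁0 p<k k<q q<L u-p v-q with ∈C? u | ∈C? v
  ... | yes u∈C | yes v∈C = ⊥-elim (c-nonadjacent (attach-positive u≁0 u-p) (≤-trans (s≤s p<k) k<q) q<L
                              (subst₂ E (attach-onC u∈C u-p) (attach-onC v∈C v-q) u-v))
  ... | yes u∈C | no  v∉C = inj₂ (attach v∉C v∉D (neighbours-interval v∉C (v≁0 ∘ attach v∉C v∉D)
                              (subst (λ w → E w v) (attach-onC u∈C u-p) u-v) (attach-offC v∉C v-q) p<k k<q q<L))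
  ... | no  u∉C | yes v∈C = inj₁ (attach u∉C u∉D (neighbours-interval u∉C (u≁0 ∘ attach u∉C u∉D)
                              (attach-offC u∉C u-p) (subst (λ w → E w u) (attach-onC v∈C v-q) (E-sym u-v)) p<k k<q q<L))
  ... | no  u∉C | no  v∉C with E-dec (c k) u | E-dec (c k) v
  ...   | yes k-u | _       = inj₁ (attach u∉C u∉D k-u)
  ...   | no  _   | yes k-v = inj₂ (attach v∉C v∉D k-v)
  ...   | no  k≁u | no  k≁v = ⊥-elim (edge-separation u∉C v∉C u-v
                                (u≁0 ∘ attach u∉C u∉D) (v≁0 ∘ attach v∉C v∉D)
                                (attach-offC u∉C u-p) (attach-offC v∉C v-q) p<k k<q q<L k≁u k≁v)

  attach-interval : ∀ {u v p k q} → E u v → ¬ InD G C u → ¬ InD G C v → ¬ Attach u 0 → ¬ Attach v 0 →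
                    p < k → k < q → q < L →
                    Attach u p ⊎ Attach v p → Attach u q ⊎ Attach v q → Attach u k ⊎ Attach v k
  attach-interval _   u∉D _   u≁0 _   p<k k<q q<L (inj₁ u-p) (inj₁ u-q) =
    inj₁ (attach-convex u∉D u≁0 p<k k<q q<L u-p u-q)
  attach-interval _   _   v∉D _   v≁0 p<k k<q q<L (inj₂ v-p) (inj₂ v-q) =
    inj₂ (attach-convex v∉D v≁0 p<k k<q q<L v-p v-q)
  attach-interval u-v u∉D v∉D u≁0 v≁0 p<k k<q q<L (inj₁ u-p) (inj₂ v-q) =
    attach-cross u-v u∉D v∉D u≁0 v≁0 p<k k<q q<L u-p v-q
  attach-interval u-v u∉D v∉D u≁0 v≁0 p<k k<q q<L (inj₂ v-p) (inj₁ u-q) =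
    swap (attach-cross (E-sym u-v) v∉D u∉D v≁0 u≁0 p<k k<q q<L v-p u-q)

  onC-attached : ∀ {u} → OnC u → ∃ λ p → p < L × Attach u p
  onC-attached (i , Ci≡u) with c-position i
  ... | p , p<L , cp≡Ci = p , p<L , inj₁ (trans (sym Ci≡u) (sym cp≡Ci))

  attached-somewhere : ∀ {u} → InClosedNbd G C u → ¬ InD G C u → ∃ λ p → p < L × Attach u p
  attached-somewhere (inj₁ u∈C) _ = onC-attached u∈C
  attached-somewhere {u} (inj₂ (i , u-Ci)) u∉D with ∈C? u | c-position i
  ... | yes u∈C | _               = onC-attached u∈C
  ... | no  u∉C | p , p<L , cp≡Ci = p , p<L , attach u∉C u∉D (subst (λ w → E w u) (sym cp≡Ci) (E-sym u-Ci))

record Connector (G : Graph) {L : ℕ} (C : Fin L → V G) (x y z : V G) {p : ℕ} (P : Fin p → V G) : Set where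
  field
    f        : ℕ → V G
    m        : ℕ
    interior : Paths.InteriorPath G x z f m
    in-Z     : ∀ {t} → t ≤ m → InZ G C x (f t) ⊎ InZ G C y (f t) ⊎ InZ G C z (f t)
    in-P     : ∀ {t} → t ≤ m → ∃ λ i → f t ≡ P i

module ConnectorIn (G : Graph) {L : ℕ} .{{_ : NonZero L}} (C : Fin L → V G)
  (shortest : IsShortestHole G C) (7≤L : 7 ≤ L)
  {p : ℕ} (P : Fin (suc p) → V G) (P-path : IsInducedPathOfGnbd G C P) (sp≢C : SpNotAll G C P)
  {x y z : V G} (xyz : ThreeConsecutive G C x y z)
  (P≢x : ∀ i → P i ≢ x) (P≢y : ∀ i → P i ≢ y) (P≢z : ∀ i → P i ≢ z)
  (x∈sp : InSp G C P x) (y∈sp : InSp G C P y) (z∈sp : InSp G C P z) where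
  open Graph G using (E)
  open Paths G
  open Decidability G C

  cut-witness : ∃ λ k → ¬ InSp G C P (C k)
  cut-witness = ¬∀⟶∃¬ L (λ i → InSp G C P (C i)) (λ i → InSp? P (C i)) sp≢C

  open Cut G C shortest 7≤L (proj₁ cut-witness)

  sp≢cut : ∀ {w} → InSp G C P w → w ≢ c 0
  sp≢cut w∈sp refl = proj₂ cut-witness (subst (InSp G C P) c-start w∈sp)

  P≁cut : ∀ i → ¬ Attach (P i) 0
  P≁cut i P-0 = proj₂ cut-witness ((proj₁ cut-witness , refl) , i , inj₁ (subst (λ v → InZ G C v (P i)) c-start P-0))

  P∉D : ∀ i → ¬ InD G C (P i)
  P∉D i = proj₂ (proj₂ P-path i)

  sp-position<L : ∀ {t w} → t ≤ L → c t ≡ w → InSp G C P w → t < L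
  sp-position<L {t} t≤L ct≡w w∈sp with m≤n⇒m<n∨m≡n t≤L
  ... | inj₁ t<L  = t<L
  ... | inj₂ refl = ⊥-elim (sp≢cut w∈sp (trans (sym ct≡w) (trans (cong c (sym (+-identityʳ L))) (c-periodic 0))))

  record Placement : Set where
    field
      r     : ℕ
      0<r   : 0 < r
      2+r<L : 2 + r < L
      at-x  : c r ≡ x
      at-y  : c (suc r) ≡ y
      at-z  : c (2 + r) ≡ z

  placement : ThreeConsecutive G C x y z → Placement
  placement (a , b , d , a→b , b→d , Ca≡x , Cb≡y , Cd≡z) = place (c-position a)
    where
    place : (∃ λ r → r < L × c r ≡ C a) → Placement
    place (r , r<L , cr≡Ca) = record
      { r = r ; 0<r = positive r (trans cr≡Ca Ca≡x) ; 2+r<L = 2+r<L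
      ; at-x = trans cr≡Ca Ca≡x ; at-y = at-y ; at-z = at-z }
      where
      positive : ∀ t → c t ≡ x → 0 < t
      positive zero    ct≡x = ⊥-elim (sp≢cut x∈sp (sym ct≡x))
      positive (suc _) _    = s≤s z≤n
      at-y : c (suc r) ≡ y
      at-y = trans (c-suc cr≡Ca a→b) Cb≡y
      at-z : c (2 + r) ≡ z
      at-z = trans (c-suc (c-suc cr≡Ca a→b) b→d) Cd≡z
      2+r<L : 2 + r < L
      2+r<L = sp-position<L (sp-position<L r<L at-y y∈sp) at-z z∈sp

  open Placement (placement xyz)

  R : ℕ → V G
  R t = P (t mod suc p)

  R-toℕ : ∀ i → R (toℕ i) ≡ P i
  R-toℕ i = cong P (toℕ-injective (trans (toℕ-fromℕ< _) (m<n⇒m%n≡m (toℕ<n i))))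

  sp-index : ∀ {w} → InSp G C P w → ∃ λ t → t ≤ p × InZ G C w (R t)
  sp-index {w} (_ , i , inj₁ w-Pi) = toℕ i , s≤s⁻¹ (toℕ<n i) , subst (InZ G C w) (sym (R-toℕ i)) w-Pi
  sp-index     (_ , i , inj₂ Pi∈D) = ⊥-elim (P∉D i Pi∈D)

  segment : MinimalSegment (InZ G C x) (InZ G C z) R p
  segment = minimalSegment (InZ? x) (InZ? z) (fin-inducedPath (proj₁ P-path))
    (proj₁ (proj₂ (sp-index x∈sp))) (proj₁ (proj₂ (sp-index z∈sp)))
    (proj₂ (proj₂ (sp-index x∈sp))) (proj₂ (proj₂ (sp-index z∈sp)))

  open MinimalSegment segment

  f-in-P : ∀ {t} → t ≤ m → ∃ λ i → f t ≡ P i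
  f-in-P t≤m with within t≤m
  ... | t′ , _ , eq = t′ mod suc p , eq

  f-inherits : ∀ (Pr : V G → Set) → (∀ i → Pr (P i)) → ∀ {t} → t ≤ m → Pr (f t)
  f-inherits Pr all-P t≤m with f-in-P t≤m
  ... | i , eq = subst Pr (sym eq) (all-P i)

  f≢ : ∀ {w} → (∀ i → P i ≢ w) → ∀ {t} → t ≤ m → f t ≢ w
  f≢ {w} = f-inherits (λ u → u ≢ w)

  f∉D : ∀ {t} → t ≤ m → ¬ InD G C (f t)
  f∉D = f-inherits (λ u → ¬ InD G C u) P∉D

  f≁cut : ∀ {t} → t ≤ m → ¬ Attach (f t) 0
  f≁cut = f-inherits (λ u → ¬ Attach u 0) P≁cut

  f-nbd : ∀ {t} → t ≤ m → InClosedNbd G C (f t)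
  f-nbd = f-inherits (InClosedNbd G C) (λ i → proj₁ (proj₂ P-path i))

  Attached : ℕ → ℕ → Set
  Attached t q = Attach (f t) q

  attached-convex : ∀ {t p k q} → t < m → p < k → k < q → q < L →
    Attached t p ⊎ Attached (suc t) p → Attached t q ⊎ Attached (suc t) q → Attached t k ⊎ Attached (suc t) k
  attached-convex t<m = attach-interval (InducedPath.step path t<m) (f∉D (<⇒≤ t<m)) (f∉D t<m)
                                        (f≁cut (<⇒≤ t<m)) (f≁cut t<m)

  attached-somewhere-inner : ∀ {t} → 0 < t → t < m → ∃ λ q → q < L × Attached t q
  attached-somewhere-inner _ t<m = attached-somewhere (f-nbd (<⇒≤ t<m)) (f∉D (<⇒≤ t<m))

  r-at-start : Attached 0 r
  r-at-start = subst (λ v → InZ G C v (f 0)) (sym at-x) X-start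

  r-only-at-start : ∀ {t} → t ≤ m → Attached t r → t ≡ 0
  r-only-at-start {t} t≤m f-r = X-only-start t≤m (subst (λ v → InZ G C v (f t)) at-x f-r)

  2+r-at-end : Attached m (2 + r)
  2+r-at-end = subst (λ v → InZ G C v (f m)) (sym at-z) Z-end

  2+r-only-at-end : ∀ {t} → t ≤ m → Attached t (2 + r) → t ≡ m
  2+r-only-at-end {t} t≤m f-2+r = Z-only-end t≤m (subst (λ v → InZ G C v (f t)) at-z f-2+r)

  module Attachments = AttachmentWalk Attached attached-convex attached-somewhere-inner 2+r<L
    r-at-start r-only-at-start 2+r-at-end 2+r-only-at-end

  f-interior-in-Zy : ∀ {t} → 0 < t → t < m → InZ G C y (f t)
  f-interior-in-Zy {t} 0<t t<m with attached-somewhere-inner 0<t t<m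
  ... | q , q<L , f-q =
    subst (λ v → InZ G C v (f t)) (trans (cong c (Attachments.inner-attachment≡1+r 0<t t<m q<L f-q)) at-y) f-q

  f-in-Z : ∀ {t} → t ≤ m → InZ G C x (f t) ⊎ InZ G C y (f t) ⊎ InZ G C z (f t)
  f-in-Z {zero}  _   = inj₁ X-start
  f-in-Z {suc t} t≤m with m≤n⇒m<n∨m≡n t≤m
  ... | inj₁ t<m   = inj₂ (inj₁ (f-interior-in-Zy (s≤s z≤n) t<m))
  ... | inj₂ 1+t≡m = inj₂ (inj₂ (subst (λ s → InZ G C z (f s)) (sym 1+t≡m) Z-end))

  InZ-offC : ∀ {v u} → u ≢ v → InZ G C v u → ¬ OnC u × E v u
  InZ-offC u≢v (inj₁ u≡v)           = ⊥-elim (u≢v u≡v)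
  InZ-offC _   (inj₂ (e , u∉C , _)) = u∉C , e

  f∉C : ∀ {t} → t ≤ m → ¬ OnC (f t)
  f∉C t≤m with f-in-Z t≤m
  ... | inj₁ in-x          = proj₁ (InZ-offC (f≢ P≢x t≤m) in-x)
  ... | inj₂ (inj₁ in-y)   = proj₁ (InZ-offC (f≢ P≢y t≤m) in-y)
  ... | inj₂ (inj₂ in-z)   = proj₁ (InZ-offC (f≢ P≢z t≤m) in-z)

  interior : InteriorPath x z f m
  interior = record
    { path         = path
    ; ≢x           = f≢ P≢x
    ; ≢z           = f≢ P≢z
    ; x-first      = proj₂ (InZ-offC (f≢ P≢x z≤n) X-start)
    ; z-last       = proj₂ (InZ-offC (f≢ P≢z ≤-refl) Z-end)
    ; x-only-first = λ t≤m e → X-only-start t≤m (inj₂ (e , f∉C t≤m , f∉D t≤m))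
    ; z-only-last  = λ t≤m e → Z-only-end t≤m (inj₂ (e , f∉C t≤m , f∉D t≤m)) }

  x≢z : x ≢ z
  x≢z x≡z = <⇒≢ (n≤1+n (suc r))
    (c-injective (<-trans (n<1+n _) (<-trans (n<1+n _) 2+r<L)) 2+r<L (trans at-x (trans x≡z (sym at-z))))

  x≁z : ¬ E x z
  x≁z e = c-nonadjacent 0<r ≤-refl 2+r<L (subst₂ E (sym at-x) (sym at-z) e)

  connector : Connector G C x y z P
  connector = record { f = f ; m = m ; interior = interior ; in-Z = f-in-Z ; in-P = f-in-P }

connectors⇒hole : ∀ {G : Graph} {L} {C : Fin L → V G} {x y z p q} {P : Fin p → V G} {Q : Fin q → V G} →
  (∀ i j → P i ≢ Q j) → (∀ i j → ¬ Graph.E G (P i) (Q j)) → x ≢ z → ¬ Graph.E G x z →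
  Connector G C x y z P → Connector G C x y z Q → HoleInZ3 G C x y z
connectors⇒hole {G} {C = C} {x} {y} {z} P≢Q P≁Q x≢z x≁z K K′ =
  _ , interiors⇒hole K.interior K′.interior disjoint anticomplete x≢z x≁z Z₃
        (inj₁ (inj₁ refl)) (inj₂ (inj₂ (inj₁ refl))) K.in-Z K′.in-Z
  where
  open Graph G using (E)
  open Paths G
  module K  = Connector K
  module K′ = Connector K′
  Z₃ : V G → Set
  Z₃ w = InZ G C x w ⊎ InZ G C y w ⊎ InZ G C z w
  disjoint : ∀ {t t′} → t ≤ K.m → t′ ≤ K′.m → K.f t ≢ K′.f t′
  disjoint t≤m t′≤m′ eq with K.in-P t≤m | K′.in-P t′≤m′
  ... | i , ft≡Pi | j , f′t′≡Qj = P≢Q i j (trans (sym ft≡Pi) (trans eq f′t′≡Qj))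
  anticomplete : ∀ {t t′} → t ≤ K.m → t′ ≤ K′.m → ¬ E (K.f t) (K′.f t′)
  anticomplete t≤m t′≤m′ e with K.in-P t≤m | K′.in-P t′≤m′
  ... | i , ft≡Pi | j , f′t′≡Qj = P≁Q i j (subst₂ E ft≡Pi f′t′≡Qj e)

avoids-sp : ∀ (G : Graph) {L} (C : Fin L → V G) {p q} {P : Fin p → V G} {Q : Fin q → V G} →
  (∀ j → ¬ InD G C (Q j)) → (∀ i j → P i ≢ Q j) → (∀ i j → ¬ Graph.E G (P i) (Q j)) →
  ∀ {w} → InSp G C Q w → ∀ i → P i ≢ w
avoids-sp G C Q∉D P≢Q P≁Q (_ , j , inj₁ (inj₁ Qj≡w))     i Pi≡w = P≢Q i j (trans Pi≡w (sym Qj≡w))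
avoids-sp G C Q∉D P≢Q P≁Q (_ , j , inj₁ (inj₂ (w-Qj , _))) i refl = P≁Q i j w-Qj
avoids-sp G C Q∉D P≢Q P≁Q (_ , j , inj₂ Qj∈D)             _ _    = Q∉D j Qj∈D

lemma4p7 : (G : Graph) {L : ℕ} (C : Fin L → V G) →
    μ₁-ceil ≤ L →
    IsShortestHole G C →
    ChordalMinusC G C →
    {p q : ℕ} (P : Fin (suc p) → V G) (Q : Fin (suc q) → V G) →
    IsInducedPathOfGnbd G C P →
    IsInducedPathOfGnbd G C Q →
    (∀ i j → P i ≢ Q j) →
    (∀ i j → ¬ Graph.E G (P i) (Q j)) →
    SpNotAll G C P →
    SpNotAll G C Q →
    (x y z : V G) →
    ThreeConsecutive G C x y z →
    InSp G C P x × InSp G C Q x →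
    InSp G C P y × InSp G C Q y →
    InSp G C P z × InSp G C Q z →
    HoleInZ3 G C x y z
lemma4p7 G {L} C μ₁≤L shortest _ P Q P-path Q-path P≢Q P≁Q P-sp≢C Q-sp≢C x y z xyz
         (x∈P , x∈Q) (y∈P , y∈Q) (z∈P , z∈Q) =
  connectors⇒hole P≢Q P≁Q ViaP.x≢z ViaP.x≁z ViaP.connector ViaQ.connector
  where
  7≤L : 7 ≤ L
  7≤L = ≤-trans (m≤m+n 7 7826) μ₁≤L
  L≢0 : NonZero L
  L≢0 = >-nonZero (≤-trans (s≤s z≤n) 7≤L)
  P-avoids : ∀ {w} → InSp G C Q w → ∀ i → P i ≢ w
  P-avoids = avoids-sp G C (proj₂ ∘ proj₂ Q-path) P≢Q P≁Q
  Q-avoids : ∀ {w} → InSp G C P w → ∀ j → Q j ≢ w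
  Q-avoids = avoids-sp G C (proj₂ ∘ proj₂ P-path) (λ j i → P≢Q i j ∘ sym) (λ j i → P≁Q i j ∘ Graph.E-sym G)
  module ViaP = ConnectorIn G {{L≢0}} C shortest 7≤L P P-path P-sp≢C xyz
    (P-avoids x∈Q) (P-avoids y∈Q) (P-avoids z∈Q) x∈P y∈P z∈P
  module ViaQ = ConnectorIn G {{L≢0}} C shortest 7≤L Q Q-path Q-sp≢C xyz
    (Q-avoids x∈P) (Q-avoids y∈P) (Q-avoids z∈P) x∈Q y∈Q z∈Q
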